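{- Let $\sigma\in\mathsf{ADR}_{n,k}$, with maximal decreasing runs $\rho_0\rho_1\cdots\rho_l$. Then the set of shifts $s$ for which $w_{\sigma,s}(c)=1$ for every letter $c$ of $\sigma$ is exactly the set of shifts $s$ such that the run $\rho_s$ contains exactly one undecorated letter.
   Context: A decorated permutation is a permutation of $[n]$ some of whose letters are marked as decorated; $\mathfrak S_n^{\bullet k}$ is the set of those with exactly $k$ decorated letters. Write $\sigma=\rho_0\cdots\rho_l$ as its maximal decreasing runs, $\tilde\rho_i$ the undecorated letters of $\rho_i$ ($\rho_{l+1}=\emptyset$). For $s\in\{0,\dots,l\}$ and $c\in\rho_i$: $w_{\sigma,s}(c)=\#\{d\in\tilde\rho_i:d>c\}+1$ if $i=s$ and $c$ undecorated; $\#\{d\in\tilde\rho_i:d>c\}+\#\{d\in\tilde\rho_{i-1}:d<c\}$ if $i>s$ and $c$ undecorated; $\#\{d\in\tilde\rho_i:d<c\}+\#\{d\in\tilde\rho_{i+1}:d>c\}$ if $i<s$ or $c$ decorated; for $s>l$ all schedule numbers are $0$. $\mathsf{ADR}_{n,k}$ is the set of $\sigma\in\mathfrak S_n^{\bullet k}$ for which some shift $s$ gives $w_{\sigma,s}(c)=1$ for all letters $c$. -}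

module Defs where

open import Data.Nat using (ℕ; zero; suc; _+_; _∸_; _<_; _≤_; _<ᵇ_; _≡ᵇ_)
open import Data.Bool using (Bool; true; false; if_then_else_; not; _∨_)
open import Data.List using (List; []; _∷_; map; length; upTo)
open import Data.Product using (_×_; _,_; proj₁; proj₂; ∃-syntax)
open import Data.List.Membership.Propositional using (_∈_)
open import Data.List.Relation.Binary.Permutation.Propositional using (_↭_)
open import Relation.Binary.PropositionalEquality using (_≡_)

Letter : Set
Letter = ℕ × Bool

val : Letter → ℕ
val = proj₁

decorated : Letter → Bool
decorated = proj₂

countB : {A : Set} → (A → Bool) → List A → ℕ
countB p [] = 0
countB p (x ∷ xs) = if p x then suc (countB p xs) else countB p xs

DecPerm : ℕ → ℕ → List Letter → Set
DecPerm n k σ = (map val σ ↭ map suc (upTo n)) × (countB decorated σ ≡ k)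

addLetter : Letter → List (List Letter) → List (List Letter)
addLetter x [] = (x ∷ []) ∷ []
addLetter x ([] ∷ rs) = (x ∷ []) ∷ rs
addLetter x ((y ∷ r) ∷ rs) =
  if val y <ᵇ val x then (x ∷ y ∷ r) ∷ rs else (x ∷ []) ∷ (y ∷ r) ∷ rs

runs : List Letter → List (List Letter)
runs [] = []
runs (x ∷ xs) = addLetter x (runs xs)

-- ρᵢ, with ρᵢ = ∅ for i > l
runAt : List (List Letter) → ℕ → List Letter
runAt [] i = []
runAt (r ∷ rs) zero = r
runAt (r ∷ rs) (suc i) = runAt rs i

undec : List Letter → List ℕ
undec [] = []
undec (x ∷ xs) = if decorated x then undec xs else val x ∷ undec xs

#greater : List ℕ → ℕ → ℕ
#greater ds c = countB (λ d → c <ᵇ d) ds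

#less : List ℕ → ℕ → ℕ
#less ds c = countB (λ d → d <ᵇ c) ds

-- schedule number w_{σ,s}(c) of a letter c lying in the run ρᵢ of σ
w : List Letter → ℕ → ℕ → Letter → ℕ
w σ s i c =
  let ρ = runs σ
      ũ : ℕ → List ℕ
      ũ j = undec (runAt ρ j)
  in if length ρ ≤ᵇ' s then 0
     else if decorated c ∨ (i <ᵇ s) then #less (ũ i) (val c) + #greater (ũ (suc i)) (val c)
     else if i ≡ᵇ s then #greater (ũ i) (val c) + 1
     else #greater (ũ i) (val c) + #less (ũ (i ∸ 1)) (val c)
  where
  _≤ᵇ'_ : ℕ → ℕ → Bool
  m ≤ᵇ' n = m <ᵇ suc n

AllOne : List Letter → ℕ → Set
AllOne σ s = ∀ (i : ℕ) (c : Letter) → i < length (runs σ) → c ∈ runAt (runs σ) i → w σ s i c ≡ 1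

ADR : ℕ → ℕ → List Letter → Set
ADR n k σ = DecPerm n k σ × ∃[ s ] AllOne σ s

-- Write ρ̃ᵢ for the (decreasing) list of undecorated values of the run ρᵢ. A shift s is valid
-- iff every decorated letter has weight 1 (a condition not involving s), consecutive pairs
-- ρ̃ᵢ, ρ̃ᵢ₊₁ satisfy a "before" weight condition for i < s and an "after" one for i ≥ s, and
-- |ρ̃ₛ| ≤ 1. Each pair condition bounds the length of the list it constrains by 2, and on such
-- short lists both are equivalent, as soon as the constrained list is nonempty, to ρ̃ᵢ and ρ̃ᵢ₊₁
-- interleaving in one of four patterns. So if s′ is valid and |ρ̃ₛ| = 1, walking from s towards
-- s′ keeps the lists nonempty and turns the conditions valid for s′ into those needed for s.
-- Conversely a valid shift s has ρ̃ₛ ≠ ∅.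

module Submission where

open import Defs
open import Data.Bool using (true; false; T)
open import Data.Bool.Properties using (T-≡)
open import Data.Empty using (⊥-elim)
open import Data.List using (List; []; _∷_; [_]; length)
open import Data.List.Membership.Propositional using (_∈_)
open import Data.List.Membership.Propositional.Properties using (∈-length)
open import Data.List.Relation.Unary.All as All using (All; []; _∷_)
open import Data.List.Relation.Unary.AllPairs as AllPairs using (AllPairs; []; _∷_)
open import Data.List.Relation.Unary.Any using (here; there)
open import Data.Nat
open import Data.Nat.Properties
open import Data.Product using (_×_; _,_; ∃; uncurry)
open import Data.Sum using (inj₁; inj₂)
open import Function using (_∘_; _on_)
open import Function.Bundles using (_⇔_; mk⇔; Equivalence)
open import Relation.Binary.Definitions using (tri<; tri≈; tri>)
open import Relation.Binary.PropositionalEquality using (_≡_; _≢_; refl; sym; trans; cong; subst)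
open import Relation.Nullary using (contradiction; yes; no)
open import Relation.Nullary.Reflects using (ofʸ; ofⁿ)

<ᵇ-true : ∀ {m n} → m < n → (m <ᵇ n) ≡ true
<ᵇ-true m<n = Equivalence.to T-≡ (<⇒<ᵇ m<n)

<ᵇ-false : ∀ {m n} → n ≤ m → (m <ᵇ n) ≡ false
<ᵇ-false {m} {n} n≤m with m <ᵇ n | <ᵇ-reflects-< m n
... | false | _       = refl
... | true  | ofʸ m<n = contradiction n≤m (<⇒≱ m<n)

<ᵇ-irrefl : ∀ n → (n <ᵇ n) ≡ false
<ᵇ-irrefl n = <ᵇ-false {n} ≤-refl

≡ᵇ-refl : ∀ n → (n ≡ᵇ n) ≡ true
≡ᵇ-refl n = Equivalence.to T-≡ (≡⇒≡ᵇ n n refl)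

≡ᵇ-false : ∀ {m n} → m ≢ n → (m ≡ᵇ n) ≡ false
≡ᵇ-false {m} {n} m≢n with m ≡ᵇ n in eq
... | false = refl
... | true  = contradiction (≡ᵇ⇒≡ m n (subst T (sym eq) _)) m≢n

interval-induction↑ : ∀ (P : ℕ → Set) {a b} → P a → (∀ j → a ≤ j → j < b → P j → P (suc j)) →
                      ∀ j → a ≤ j → j ≤ b → P j
interval-induction↑ P {a} Pa step j a≤j j≤b with m≤n⇒m<n∨m≡n a≤j
... | inj₂ refl = Pa
interval-induction↑ P Pa step (suc j) _ j<b | inj₁ (s≤s a≤j) =
  step j a≤j j<b (interval-induction↑ P Pa step j a≤j (<⇒≤ j<b))

interval-induction↓ : ∀ (P : ℕ → Set) {a b} → P b → (∀ j → a ≤ j → j < b → P (suc j) → P j) →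
                      ∀ j → a ≤ j → j ≤ b → P j
interval-induction↓ P {a} {b} Pb step j a≤j j≤b with m≤n⇒m<n∨m≡n j≤b
... | inj₂ refl = Pb
interval-induction↓ P {a} {suc b} Pb step j a≤j _ | inj₁ (s≤s j≤b) =
  interval-induction↓ P (step b (≤-trans a≤j j≤b) ≤-refl Pb)
    (λ k a≤k k<b → step k a≤k (m<n⇒m<1+n k<b)) j a≤j j≤b

Descending : List ℕ → Set
Descending = AllPairs _>_

weightBefore : List ℕ → List ℕ → ℕ → ℕ
weightBefore U next v = #less U v + #greater next v

weightAfter : List ℕ → List ℕ → ℕ → ℕ
weightAfter U prev v = #greater U v + #less prev v

UnitBefore : List ℕ → List ℕ → Set
UnitBefore U next = ∀ v → v ∈ U → weightBefore U next v ≡ 1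

UnitAfter : List ℕ → List ℕ → Set
UnitAfter U prev = ∀ v → v ∈ U → weightAfter U prev v ≡ 1

-- Merging U and V decreasingly (an element of U before an equal one of V) reads vu, vuv, uvu or uvuv.
data Interleaved : List ℕ → List ℕ → Set where
  vu   : ∀ {u v} → u < v → Interleaved [ u ] [ v ]
  vuv  : ∀ {u v v′} → v′ ≤ u → u < v → Interleaved [ u ] (v ∷ v′ ∷ [])
  uvu  : ∀ {u u′ v} → u′ < v → v ≤ u → Interleaved (u ∷ u′ ∷ []) [ v ]
  uvuv : ∀ {u u′ v v′} → v′ ≤ u′ → u′ < v → v ≤ u → Interleaved (u ∷ u′ ∷ []) (v ∷ v′ ∷ [])

Interleaved⇒nonemptyˡ : ∀ {U V} → Interleaved U V → 0 < length U
Interleaved⇒nonemptyˡ (vu _)       = z<s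
Interleaved⇒nonemptyˡ (vuv _ _)    = z<s
Interleaved⇒nonemptyˡ (uvu _ _)    = z<s
Interleaved⇒nonemptyˡ (uvuv _ _ _) = z<s

Interleaved⇒nonemptyʳ : ∀ {U V} → Interleaved U V → 0 < length V
Interleaved⇒nonemptyʳ (vu _)       = z<s
Interleaved⇒nonemptyʳ (vuv _ _)    = z<s
Interleaved⇒nonemptyʳ (uvu _ _)    = z<s
Interleaved⇒nonemptyʳ (uvuv _ _ _) = z<s

Interleaved⇒UnitBefore : ∀ {U V} → Interleaved U V → UnitBefore U V
Interleaved⇒UnitBefore (vu {u} u<v) _ (here refl)
  rewrite <ᵇ-irrefl u | <ᵇ-true u<v = refl
Interleaved⇒UnitBefore (vuv {u} v′≤u u<v) _ (here refl)
  rewrite <ᵇ-irrefl u | <ᵇ-true u<v | <ᵇ-false v′≤u = refl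
Interleaved⇒UnitBefore (uvu {u} {u′} u′<v v≤u) _ (here refl)
  rewrite <ᵇ-irrefl u | <ᵇ-true (<-≤-trans u′<v v≤u) | <ᵇ-false v≤u = refl
Interleaved⇒UnitBefore (uvu {u} {u′} u′<v v≤u) _ (there (here refl))
  rewrite <ᵇ-false (<⇒≤ (<-≤-trans u′<v v≤u)) | <ᵇ-irrefl u′ | <ᵇ-true u′<v = refl
Interleaved⇒UnitBefore (uvuv {u} {u′} v′≤u′ u′<v v≤u) _ (here refl)
  rewrite <ᵇ-irrefl u | <ᵇ-true (<-≤-trans u′<v v≤u) | <ᵇ-false v≤u
        | <ᵇ-false (≤-trans v′≤u′ (<⇒≤ (<-≤-trans u′<v v≤u))) = refl
Interleaved⇒UnitBefore (uvuv {u} {u′} v′≤u′ u′<v v≤u) _ (there (here refl))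
  rewrite <ᵇ-false (<⇒≤ (<-≤-trans u′<v v≤u)) | <ᵇ-irrefl u′ | <ᵇ-true u′<v | <ᵇ-false v′≤u′ = refl

Interleaved⇒UnitAfter : ∀ {U V} → Interleaved U V → UnitAfter V U
Interleaved⇒UnitAfter (vu {u} {v} u<v) _ (here refl)
  rewrite <ᵇ-irrefl v | <ᵇ-true u<v = refl
Interleaved⇒UnitAfter (vuv {u} {v} {v′} v′≤u u<v) _ (here refl)
  rewrite <ᵇ-irrefl v | <ᵇ-false (<⇒≤ (≤-<-trans v′≤u u<v)) | <ᵇ-true u<v = refl
Interleaved⇒UnitAfter (vuv {u} {v} {v′} v′≤u u<v) _ (there (here refl))
  rewrite <ᵇ-true (≤-<-trans v′≤u u<v) | <ᵇ-irrefl v′ | <ᵇ-false v′≤u = refl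
Interleaved⇒UnitAfter (uvu {u} {u′} {v} u′<v v≤u) _ (here refl)
  rewrite <ᵇ-irrefl v | <ᵇ-false v≤u | <ᵇ-true u′<v = refl
Interleaved⇒UnitAfter (uvuv {u} {u′} {v} {v′} v′≤u′ u′<v v≤u) _ (here refl)
  rewrite <ᵇ-irrefl v | <ᵇ-false (<⇒≤ (≤-<-trans v′≤u′ u′<v)) | <ᵇ-false v≤u | <ᵇ-true u′<v = refl
Interleaved⇒UnitAfter (uvuv {u} {u′} {v} {v′} v′≤u′ u′<v v≤u) _ (there (here refl))
  rewrite <ᵇ-true (≤-<-trans v′≤u′ u′<v) | <ᵇ-irrefl v′
        | <ᵇ-false (≤-trans v′≤u′ (<⇒≤ (<-≤-trans u′<v v≤u))) | <ᵇ-false v′≤u′ = refl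

UnitBefore⇒length≤2 : ∀ {U V} → Descending U → UnitBefore U V → length U ≤ 2
UnitBefore⇒length≤2 {[]}                  _ _ = z≤n
UnitBefore⇒length≤2 {_ ∷ []}              _ _ = s≤s z≤n
UnitBefore⇒length≤2 {_ ∷ _ ∷ []}          _ _ = s≤s (s≤s z≤n)
UnitBefore⇒length≤2 {x ∷ y ∷ z ∷ r} {V} ((y<x ∷ z<x ∷ _) ∷ _) unit = ⊥-elim (weight≥2 (unit x (here refl)))
  where
  weight≥2 : weightBefore (x ∷ y ∷ z ∷ r) V x ≢ 1
  weight≥2 rewrite <ᵇ-irrefl x | <ᵇ-true y<x | <ᵇ-true z<x = λ ()

UnitAfter⇒length≤2 : ∀ {U V} → Descending U → UnitAfter U V → length U ≤ 2
UnitAfter⇒length≤2 {[]}                  _ _ = z≤n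
UnitAfter⇒length≤2 {_ ∷ []}              _ _ = s≤s z≤n
UnitAfter⇒length≤2 {_ ∷ _ ∷ []}          _ _ = s≤s (s≤s z≤n)
UnitAfter⇒length≤2 {x ∷ y ∷ z ∷ r} {V} ((_ ∷ z<x ∷ _) ∷ (z<y ∷ _) ∷ _) unit =
  ⊥-elim (weight≥2 (unit z (there (there (here refl)))))
  where
  weight≥2 : weightAfter (x ∷ y ∷ z ∷ r) V z ≢ 1
  weight≥2 rewrite <ᵇ-true z<x | <ᵇ-true z<y = λ ()

UnitBefore⇒Interleaved : ∀ {U V} → Descending U → Descending V → 0 < length U → length V ≤ 2 →
                         UnitBefore U V → Interleaved U V
UnitBefore⇒Interleaved {_ ∷ _ ∷ _ ∷ _} {V} dU _ _ _ unit with UnitBefore⇒length≤2 {V = V} dU unit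
... | s≤s (s≤s ())
UnitBefore⇒Interleaved {V = _ ∷ _ ∷ _ ∷ _} _ _ _ (s≤s (s≤s ())) _
UnitBefore⇒Interleaved {u ∷ []} {[]} _ _ _ _ unit = ⊥-elim (weight≡0 (unit u (here refl)))
  where
  weight≡0 : weightBefore [ u ] [] u ≢ 1
  weight≡0 rewrite <ᵇ-irrefl u = λ ()
UnitBefore⇒Interleaved {u ∷ u′ ∷ []} {[]} ((u′<u ∷ []) ∷ _) _ _ _ unit =
  ⊥-elim (weight≡0 (unit u′ (there (here refl))))
  where
  weight≡0 : weightBefore (u ∷ u′ ∷ []) [] u′ ≢ 1
  weight≡0 rewrite <ᵇ-false (<⇒≤ u′<u) | <ᵇ-irrefl u′ = λ ()
UnitBefore⇒Interleaved {u ∷ []} {v ∷ []} _ _ _ _ unit = vu (at-u (unit u (here refl)))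
  where
  at-u : weightBefore [ u ] [ v ] u ≡ 1 → u < v
  at-u rewrite <ᵇ-irrefl u with u <ᵇ v | <ᵇ-reflects-< u v
  ... | true  | ofʸ u<v = λ _ → u<v
  ... | false | _       = λ ()
UnitBefore⇒Interleaved {u ∷ []} {v ∷ v′ ∷ []} _ ((v′<v ∷ []) ∷ _) _ _ unit =
  uncurry vuv (at-u (unit u (here refl)))
  where
  at-u : weightBefore [ u ] (v ∷ v′ ∷ []) u ≡ 1 → v′ ≤ u × u < v
  at-u rewrite <ᵇ-irrefl u with u <ᵇ v | <ᵇ-reflects-< u v | u <ᵇ v′ | <ᵇ-reflects-< u v′
  ... | true  | ofʸ u<v | false | ofⁿ u≮v′ = λ _ → ≮⇒≥ u≮v′ , u<v
  ... | true  | _       | true  | _        = λ ()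
  ... | false | ofⁿ u≮v | true  | ofʸ u<v′ = contradiction (<-trans u<v′ v′<v) u≮v
  ... | false | _       | false | _        = λ ()
UnitBefore⇒Interleaved {u ∷ u′ ∷ []} {v ∷ []} ((u′<u ∷ []) ∷ _) _ _ _ unit =
  uvu (at-u′ (unit u′ (there (here refl)))) (at-u (unit u (here refl)))
  where
  at-u : weightBefore (u ∷ u′ ∷ []) [ v ] u ≡ 1 → v ≤ u
  at-u rewrite <ᵇ-irrefl u | <ᵇ-true u′<u with u <ᵇ v | <ᵇ-reflects-< u v
  ... | false | ofⁿ u≮v = λ _ → ≮⇒≥ u≮v
  ... | true  | _       = λ ()
  at-u′ : weightBefore (u ∷ u′ ∷ []) [ v ] u′ ≡ 1 → u′ < v
  at-u′ rewrite <ᵇ-false (<⇒≤ u′<u) | <ᵇ-irrefl u′ with u′ <ᵇ v | <ᵇ-reflects-< u′ v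
  ... | true  | ofʸ u′<v = λ _ → u′<v
  ... | false | _        = λ ()
UnitBefore⇒Interleaved {u ∷ u′ ∷ []} {v ∷ v′ ∷ []} ((u′<u ∷ []) ∷ _) ((v′<v ∷ []) ∷ _) _ _ unit =
  uncurry uvuv (at-u′ (unit u′ (there (here refl)))) (at-u (unit u (here refl)))
  where
  at-u : weightBefore (u ∷ u′ ∷ []) (v ∷ v′ ∷ []) u ≡ 1 → v ≤ u
  at-u rewrite <ᵇ-irrefl u | <ᵇ-true u′<u with u <ᵇ v | <ᵇ-reflects-< u v
  ... | false | ofⁿ u≮v = λ _ → ≮⇒≥ u≮v
  ... | true  | _       = λ ()
  at-u′ : weightBefore (u ∷ u′ ∷ []) (v ∷ v′ ∷ []) u′ ≡ 1 → v′ ≤ u′ × u′ < v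
  at-u′ rewrite <ᵇ-false (<⇒≤ u′<u) | <ᵇ-irrefl u′
    with u′ <ᵇ v | <ᵇ-reflects-< u′ v | u′ <ᵇ v′ | <ᵇ-reflects-< u′ v′
  ... | true  | ofʸ u′<v | false | ofⁿ u′≮v′ = λ _ → ≮⇒≥ u′≮v′ , u′<v
  ... | true  | _        | true  | _         = λ ()
  ... | false | ofⁿ u′≮v | true  | ofʸ u′<v′ = contradiction (<-trans u′<v′ v′<v) u′≮v
  ... | false | _        | false | _         = λ ()

UnitAfter⇒Interleaved : ∀ {U V} → Descending U → Descending V → 0 < length V → length U ≤ 2 →
                        UnitAfter V U → Interleaved U V
UnitAfter⇒Interleaved {U} {_ ∷ _ ∷ _ ∷ _} _ dV _ _ unit with UnitAfter⇒length≤2 {V = U} dV unit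
... | s≤s (s≤s ())
UnitAfter⇒Interleaved {_ ∷ _ ∷ _ ∷ _} _ _ _ (s≤s (s≤s ())) _
UnitAfter⇒Interleaved {[]} {v ∷ []} _ _ _ _ unit = ⊥-elim (weight≡0 (unit v (here refl)))
  where
  weight≡0 : weightAfter [ v ] [] v ≢ 1
  weight≡0 rewrite <ᵇ-irrefl v = λ ()
UnitAfter⇒Interleaved {[]} {v ∷ v′ ∷ []} _ ((v′<v ∷ []) ∷ _) _ _ unit =
  ⊥-elim (weight≡0 (unit v (here refl)))
  where
  weight≡0 : weightAfter (v ∷ v′ ∷ []) [] v ≢ 1
  weight≡0 rewrite <ᵇ-irrefl v | <ᵇ-false (<⇒≤ v′<v) = λ ()
UnitAfter⇒Interleaved {u ∷ []} {v ∷ []} _ _ _ _ unit = vu (at-v (unit v (here refl)))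
  where
  at-v : weightAfter [ v ] [ u ] v ≡ 1 → u < v
  at-v rewrite <ᵇ-irrefl v with u <ᵇ v | <ᵇ-reflects-< u v
  ... | true  | ofʸ u<v = λ _ → u<v
  ... | false | _       = λ ()
UnitAfter⇒Interleaved {u ∷ []} {v ∷ v′ ∷ []} _ ((v′<v ∷ []) ∷ _) _ _ unit =
  vuv (at-v′ (unit v′ (there (here refl)))) (at-v (unit v (here refl)))
  where
  at-v : weightAfter (v ∷ v′ ∷ []) [ u ] v ≡ 1 → u < v
  at-v rewrite <ᵇ-irrefl v | <ᵇ-false (<⇒≤ v′<v) with u <ᵇ v | <ᵇ-reflects-< u v
  ... | true  | ofʸ u<v = λ _ → u<v
  ... | false | _       = λ ()
  at-v′ : weightAfter (v ∷ v′ ∷ []) [ u ] v′ ≡ 1 → v′ ≤ u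
  at-v′ rewrite <ᵇ-true v′<v | <ᵇ-irrefl v′ with u <ᵇ v′ | <ᵇ-reflects-< u v′
  ... | false | ofⁿ u≮v′ = λ _ → ≮⇒≥ u≮v′
  ... | true  | _        = λ ()
UnitAfter⇒Interleaved {u ∷ u′ ∷ []} {v ∷ []} ((u′<u ∷ []) ∷ _) _ _ _ unit =
  uncurry uvu (at-v (unit v (here refl)))
  where
  at-v : weightAfter [ v ] (u ∷ u′ ∷ []) v ≡ 1 → u′ < v × v ≤ u
  at-v rewrite <ᵇ-irrefl v with u <ᵇ v | <ᵇ-reflects-< u v | u′ <ᵇ v | <ᵇ-reflects-< u′ v
  ... | false | ofⁿ u≮v | true  | ofʸ u′<v = λ _ → u′<v , ≮⇒≥ u≮v
  ... | true  | _       | true  | _        = λ ()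
  ... | true  | ofʸ u<v | false | ofⁿ u′≮v = contradiction (<-trans u′<u u<v) u′≮v
  ... | false | _       | false | _        = λ ()
UnitAfter⇒Interleaved {u ∷ u′ ∷ []} {v ∷ v′ ∷ []} ((u′<u ∷ []) ∷ _) ((v′<v ∷ []) ∷ _) _ _ unit =
  let u′<v , v≤u = at-v (unit v (here refl)) in uvuv (at-v′ (unit v′ (there (here refl)))) u′<v v≤u
  where
  at-v : weightAfter (v ∷ v′ ∷ []) (u ∷ u′ ∷ []) v ≡ 1 → u′ < v × v ≤ u
  at-v rewrite <ᵇ-irrefl v | <ᵇ-false (<⇒≤ v′<v)
    with u <ᵇ v | <ᵇ-reflects-< u v | u′ <ᵇ v | <ᵇ-reflects-< u′ v
  ... | false | ofⁿ u≮v | true  | ofʸ u′<v = λ _ → u′<v , ≮⇒≥ u≮v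
  ... | true  | _       | true  | _        = λ ()
  ... | true  | ofʸ u<v | false | ofⁿ u′≮v = contradiction (<-trans u′<u u<v) u′≮v
  ... | false | _       | false | _        = λ ()
  at-v′ : weightAfter (v ∷ v′ ∷ []) (u ∷ u′ ∷ []) v′ ≡ 1 → v′ ≤ u′
  at-v′ rewrite <ᵇ-true v′<v | <ᵇ-irrefl v′ with u <ᵇ v′ | u′ <ᵇ v′ | <ᵇ-reflects-< u′ v′
  ... | false | false | ofⁿ u′≮v′ = λ _ → ≮⇒≥ u′≮v′
  ... | false | true  | _         = λ ()
  ... | true  | _     | _         = λ ()

#greater≡0 : ∀ {x xs} → All (_≤ x) xs → #greater xs x ≡ 0
#greater≡0 []                     = refl
#greater≡0 {x} (_∷_ {y} y≤x ys≤x) rewrite <ᵇ-false {x} {y} y≤x = #greater≡0 ys≤x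

UnitAfter-[] : ∀ {V} → Descending V → UnitAfter V [] → V ≡ []
UnitAfter-[] {[]}     _          _    = refl
UnitAfter-[] {v ∷ vs} (vs<v ∷ _) unit = ⊥-elim (weight≡0 (unit v (here refl)))
  where
  weight≡0 : weightAfter (v ∷ vs) [] v ≢ 1
  weight≡0 rewrite <ᵇ-irrefl v | #greater≡0 (All.map <⇒≤ vs<v) = λ ()

noneGreater⇒length≤1 : ∀ {U} → Descending U → (∀ v → v ∈ U → #greater U v ≡ 0) → length U ≤ 1
noneGreater⇒length≤1 {[]}        _ _ = z≤n
noneGreater⇒length≤1 {_ ∷ []}    _ _ = s≤s z≤n
noneGreater⇒length≤1 {x ∷ y ∷ r} ((y<x ∷ _) ∷ _) none = ⊥-elim (x-above-y (none y (there (here refl))))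
  where
  x-above-y : #greater (x ∷ y ∷ r) y ≢ 0
  x-above-y rewrite <ᵇ-true y<x = λ ()

length≤1⇒noneGreater : ∀ {U} → length U ≤ 1 → ∀ v → v ∈ U → #greater U v ≡ 0
length≤1⇒noneGreater {x ∷ []} _ _ (here refl) rewrite <ᵇ-irrefl x = refl
length≤1⇒noneGreater {_ ∷ _ ∷ _} (s≤s ())

DecreasingRun : List Letter → Set
DecreasingRun = AllPairs (_>_ on val)

addLetter-decreasing : ∀ x R → All DecreasingRun R → All DecreasingRun (addLetter x R)
addLetter-decreasing x []              _        = ([] ∷ []) ∷ []
addLetter-decreasing x ([] ∷ rs)       (_ ∷ ds) = ([] ∷ []) ∷ ds
addLetter-decreasing x ((y ∷ r) ∷ rs)  (d ∷ ds) with val y <ᵇ val x | <ᵇ-reflects-< (val y) (val x)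
... | true  | ofʸ y<x = ((y<x ∷ All.map (λ z<y → <-trans z<y y<x) (AllPairs.head d)) ∷ d) ∷ ds
... | false | _       = ([] ∷ []) ∷ d ∷ ds

runs-decreasing : ∀ σ → All DecreasingRun (runs σ)
runs-decreasing []      = []
runs-decreasing (x ∷ σ) = addLetter-decreasing x (runs σ) (runs-decreasing σ)

addLetter-inhabited : ∀ x R → All (λ r → ∃ (_∈ r)) R → All (λ r → ∃ (_∈ r)) (addLetter x R)
addLetter-inhabited x []             _        = (x , here refl) ∷ []
addLetter-inhabited x ([] ∷ rs)      (_ ∷ is) = (x , here refl) ∷ is
addLetter-inhabited x ((y ∷ r) ∷ rs) (i ∷ is) with val y <ᵇ val x
... | true  = (x , here refl) ∷ is
... | false = (x , here refl) ∷ i ∷ is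

runs-inhabited : ∀ σ → All (λ r → ∃ (_∈ r)) (runs σ)
runs-inhabited []      = []
runs-inhabited (x ∷ σ) = addLetter-inhabited x (runs σ) (runs-inhabited σ)

All-runAt : ∀ {P : List Letter → Set} {R} → All P R → P [] → ∀ i → P (runAt R i)
All-runAt []         P[] _       = P[]
All-runAt (pr ∷ _)   _   zero    = pr
All-runAt (_ ∷ prs)  P[] (suc i) = All-runAt prs P[] i

All-runAt< : ∀ {P : List Letter → Set} {R} → All P R → ∀ i → i < length R → P (runAt R i)
All-runAt< (pr ∷ _)  zero    _         = pr
All-runAt< (_ ∷ prs) (suc i) (s≤s i<l) = All-runAt< prs i i<l

runAt-∈⇒< : ∀ R i {c} → c ∈ runAt R i → i < length R
runAt-∈⇒< (_ ∷ _)  zero    _   = z<s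
runAt-∈⇒< (_ ∷ rs) (suc i) c∈ = s≤s (runAt-∈⇒< rs i c∈)

undec-All : ∀ {P : ℕ → Set} {r} → All (P ∘ val) r → All P (undec r)
undec-All                       []       = []
undec-All {r = (_ , true)  ∷ _} (_ ∷ ps) = undec-All ps
undec-All {r = (_ , false) ∷ _} (p ∷ ps) = p ∷ undec-All ps

undec-descending : ∀ {r} → DecreasingRun r → Descending (undec r)
undec-descending                   []        = []
undec-descending {(_ , true)  ∷ _} (_ ∷ d)   = undec-descending d
undec-descending {(_ , false) ∷ _} (r<x ∷ d) = undec-All r<x ∷ undec-descending d

∈-undec⁺ : ∀ {r v} → (v , false) ∈ r → v ∈ undec r
∈-undec⁺ {(_ , false) ∷ _} (here refl) = here refl
∈-undec⁺ {(_ , true)  ∷ _} (there v∈) = ∈-undec⁺ v∈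
∈-undec⁺ {(_ , false) ∷ _} (there v∈) = there (∈-undec⁺ v∈)

∈-undec⁻ : ∀ {r v} → v ∈ undec r → (v , false) ∈ r
∈-undec⁻ {(_ , true)  ∷ _} v∈         = there (∈-undec⁻ v∈)
∈-undec⁻ {(_ , false) ∷ _} (here refl) = here refl
∈-undec⁻ {(_ , false) ∷ _} (there v∈) = there (∈-undec⁻ v∈)

undecRun : List Letter → ℕ → List ℕ
undecRun σ i = undec (runAt (runs σ) i)

undecRun-descending : ∀ σ i → Descending (undecRun σ i)
undecRun-descending σ i = undec-descending (All-runAt (runs-decreasing σ) [] i)

weightBefore≡1⇒nonempty : ∀ {U V v} → Descending V → UnitAfter V U →
                          weightBefore U V v ≡ 1 → 0 < length U
weightBefore≡1⇒nonempty {_ ∷ _} _  _    _ = z<s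
weightBefore≡1⇒nonempty {[]}    dV unit weight≡1 with UnitAfter-[] dV unit
weightBefore≡1⇒nonempty {[]} _ _ () | refl

weight-beyond : ∀ σ {s i} c → length (runs σ) ≤ s → w σ s i c ≡ 0
weight-beyond σ {s} _ L≤s rewrite <ᵇ-true {length (runs σ)} {suc s} (s≤s L≤s) = refl

weight-decorated : ∀ σ {s} i v → s < length (runs σ) →
                   w σ s i (v , true) ≡ weightBefore (undecRun σ i) (undecRun σ (suc i)) v
weight-decorated σ {s} _ _ s<L rewrite <ᵇ-false {length (runs σ)} {suc s} s<L = refl

weight-before : ∀ σ {s i} v → s < length (runs σ) → i < s →
                w σ s i (v , false) ≡ weightBefore (undecRun σ i) (undecRun σ (suc i)) v
weight-before σ {s} _ s<L i<s rewrite <ᵇ-false {length (runs σ)} {suc s} s<L | <ᵇ-true i<s = refl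

weight-at : ∀ σ {s} v → s < length (runs σ) → w σ s s (v , false) ≡ #greater (undecRun σ s) v + 1
weight-at σ {s} _ s<L rewrite <ᵇ-false {length (runs σ)} {suc s} s<L | <ᵇ-irrefl s | ≡ᵇ-refl s = refl

weight-after : ∀ σ {s i} v → s < length (runs σ) → s < i →
               w σ s i (v , false) ≡ weightAfter (undecRun σ i) (undecRun σ (i ∸ 1)) v
weight-after σ {s} _ s<L s<i
  rewrite <ᵇ-false {length (runs σ)} {suc s} s<L | <ᵇ-false (<⇒≤ s<i) | ≡ᵇ-false (>⇒≢ s<i) = refl

record UnitShift (σ : List Letter) (s : ℕ) : Set where
  field
    decorated-unit : ∀ i v → (v , true) ∈ runAt (runs σ) i →
                     weightBefore (undecRun σ i) (undecRun σ (suc i)) v ≡ 1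
    before         : ∀ i → i < s → UnitBefore (undecRun σ i) (undecRun σ (suc i))
    at             : length (undecRun σ s) ≤ 1
    after          : ∀ i → s < i → UnitAfter (undecRun σ i) (undecRun σ (i ∸ 1))

AllOne⇒UnitShift : ∀ σ {s} → s < length (runs σ) → AllOne σ s → UnitShift σ s
AllOne⇒UnitShift σ {s} s<L allOne = record
  { decorated-unit = λ i v v∈ → trans (sym (weight-decorated σ i v s<L)) (unit v∈)
  ; before         = λ i i<s v v∈ → trans (sym (weight-before σ v s<L i<s)) (unit (∈-undec⁻ v∈))
  ; at             = noneGreater⇒length≤1 (undecRun-descending σ s) λ v v∈ →
                       +-cancelʳ-≡ 1 _ 0 (trans (sym (weight-at σ v s<L)) (unit (∈-undec⁻ v∈)))
  ; after          = λ i s<i v v∈ → trans (sym (weight-after σ v s<L s<i)) (unit (∈-undec⁻ v∈))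
  }
  where
  unit : ∀ {i c} → c ∈ runAt (runs σ) i → w σ s i c ≡ 1
  unit {i} {c} c∈ = allOne i c (runAt-∈⇒< (runs σ) i c∈) c∈

UnitShift⇒AllOne : ∀ σ {s} → s < length (runs σ) → UnitShift σ s → AllOne σ s
UnitShift⇒AllOne σ s<L shift i (v , true) _ v∈ =
  trans (weight-decorated σ i v s<L) (UnitShift.decorated-unit shift i v v∈)
UnitShift⇒AllOne σ {s} s<L shift i (v , false) _ v∈ with <-cmp i s
... | tri< i<s _ _ = trans (weight-before σ v s<L i<s) (UnitShift.before shift i i<s v (∈-undec⁺ v∈))
... | tri≈ _ refl _ =
  trans (weight-at σ v s<L) (cong (_+ 1) (length≤1⇒noneGreater (UnitShift.at shift) v (∈-undec⁺ v∈)))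
... | tri> _ _ s<i = trans (weight-after σ v s<L s<i) (UnitShift.after shift i s<i v (∈-undec⁺ v∈))

AllOne⇒<length : ∀ σ {s} → 0 < length (runs σ) → AllOne σ s → s < length (runs σ)
AllOne⇒<length σ {s} 0<L allOne with s <? length (runs σ)
... | yes s<L = s<L
... | no  s≮L =
  let c , c∈ = All-runAt< (runs-inhabited σ) 0 0<L
  in contradiction (trans (sym (weight-beyond σ c (≮⇒≥ s≮L))) (allOne 0 c 0<L c∈)) λ ()

UnitShift⇒length≤2 : ∀ σ {s} → UnitShift σ s → ∀ i → length (undecRun σ i) ≤ 2
UnitShift⇒length≤2 σ {s} shift i with <-cmp i s
... | tri< i<s _ _ =
  UnitBefore⇒length≤2 {V = undecRun σ (suc i)} (undecRun-descending σ i) (UnitShift.before shift i i<s)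
... | tri≈ _ refl _ = m≤n⇒m≤1+n (UnitShift.at shift)
... | tri> _ _ s<i =
  UnitAfter⇒length≤2 {V = undecRun σ (i ∸ 1)} (undecRun-descending σ i) (UnitShift.after shift i s<i)

-- If ρ̃ₛ = ∅, a decorated letter of ρₛ has weight 1 only if ρ̃ₛ₊₁ ≠ ∅, but then the top of ρ̃ₛ₊₁
-- has weight 0.
UnitShift⇒length≡1 : ∀ σ {s} → s < length (runs σ) → UnitShift σ s → length (undecRun σ s) ≡ 1
UnitShift⇒length≡1 σ {s} s<L shift = ≤-antisym (UnitShift.at shift) nonempty
  where
  nonempty : 0 < length (undecRun σ s)
  nonempty with All-runAt< (runs-inhabited σ) s s<L
  ... | (v , false) , v∈ = ∈-length (∈-undec⁺ v∈)
  ... | (v , true)  , v∈ = weightBefore≡1⇒nonempty {U = undecRun σ s} (undecRun-descending σ (suc s))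
                             (UnitShift.after shift (suc s) ≤-refl) (UnitShift.decorated-unit shift s v v∈)

UnitShift-transfer : ∀ σ {s s′} → UnitShift σ s′ → length (undecRun σ s) ≡ 1 → UnitShift σ s
UnitShift-transfer σ {s} {s′} shift′ len≡1 = record
  { decorated-unit = UnitShift.decorated-unit shift′
  ; before         = before
  ; at             = ≤-reflexive len≡1
  ; after          = after
  }
  where
  ũ : ℕ → List ℕ
  ũ = undecRun σ
  up-step : ∀ j → j < s′ → 0 < length (ũ j) → Interleaved (ũ j) (ũ (suc j))
  up-step j j<s′ ne = UnitBefore⇒Interleaved (undecRun-descending σ j) (undecRun-descending σ (suc j)) ne
                        (UnitShift⇒length≤2 σ shift′ (suc j)) (UnitShift.before shift′ j j<s′)
  down-step : ∀ j → s′ ≤ j → 0 < length (ũ (suc j)) → Interleaved (ũ j) (ũ (suc j))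
  down-step j s′≤j ne = UnitAfter⇒Interleaved (undecRun-descending σ j) (undecRun-descending σ (suc j)) ne
                          (UnitShift⇒length≤2 σ shift′ j) (UnitShift.after shift′ (suc j) (s≤s s′≤j))
  nonempty-s : 0 < length (ũ s)
  nonempty-s = ≤-reflexive (sym len≡1)
  nonempty↑ : ∀ j → s ≤ j → j ≤ s′ → 0 < length (ũ j)
  nonempty↑ = interval-induction↑ (λ j → 0 < length (ũ j)) nonempty-s
                (λ j _ j<s′ ne → Interleaved⇒nonemptyʳ (up-step j j<s′ ne))
  nonempty↓ : ∀ j → s′ ≤ j → j ≤ s → 0 < length (ũ j)
  nonempty↓ = interval-induction↓ (λ j → 0 < length (ũ j)) nonempty-s
                (λ j s′≤j _ ne → Interleaved⇒nonemptyˡ (down-step j s′≤j ne))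
  before : ∀ i → i < s → UnitBefore (ũ i) (ũ (suc i))
  before i i<s with i <? s′
  ... | yes i<s′ = UnitShift.before shift′ i i<s′
  ... | no  i≮s′ =
    Interleaved⇒UnitBefore (down-step i (≮⇒≥ i≮s′) (nonempty↓ (suc i) (m≤n⇒m≤1+n (≮⇒≥ i≮s′)) i<s))
  after : ∀ i → s < i → UnitAfter (ũ i) (ũ (i ∸ 1))
  after i s<i with s′ <? i
  ... | yes s′<i = UnitShift.after shift′ i s′<i
  after (suc j) (s≤s s≤j) | no s′≮i =
    Interleaved⇒UnitAfter (up-step j (≮⇒≥ s′≮i) (nonempty↑ j s≤j (<⇒≤ (≮⇒≥ s′≮i))))

mainTheorem14 : (n k : ℕ) (σ : List Letter) → ADR n k σ →
    (s : ℕ) → s < length (runs σ) →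
      AllOne σ s ⇔ (length (undec (runAt (runs σ) s)) ≡ 1)
mainTheorem14 _ _ σ (_ , s′ , allOne′) s s<L = mk⇔
  (λ allOne → UnitShift⇒length≡1 σ s<L (AllOne⇒UnitShift σ s<L allOne))
  (λ len≡1 → UnitShift⇒AllOne σ s<L (UnitShift-transfer σ (AllOne⇒UnitShift σ s′<L allOne′) len≡1))
  where
  s′<L : s′ < length (runs σ)
  s′<L = AllOne⇒<length σ (≤-<-trans z≤n s<L) allOne′
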